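{- For every $m \in \mathbb{N}$ there is a constant $c_m>0$ such that for every $n \geq 1$ there exist $m$ $n$-pencils in the real projective plane whose centres are in general position (no three of the $m$ centres are collinear) and which determine at least $c_m n^{3/2}$ $m$-rich points.
   Context: An $n$-pencil with centre $p \in P^2(\mathbb{R})$ is a set of $n$ distinct concurrent lines all passing through $p$. Given $m$ pencils, a point is called $m$-rich if it lies on at least one line from each of the $m$ pencils. -}

module Defs where

open import Level using (0ℓ)
open import Data.Nat using (ℕ; zero; suc; _^_)
open import Data.Fin using (Fin)
open import Data.Product using (Σ; ∃; _×_; _,_)
open import Data.Sum using (_⊎_)
open import Relation.Nullary using (¬_)
open import Relation.Binary.PropositionalEquality using (_≡_)
open import Relation.Binary.Structures using (IsTotalOrder)
open import Algebra.Structures using (IsCommutativeRing)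

-- A complete ordered field (i.e. a model of the real numbers ℝ; all such
-- structures are isomorphic to ℝ).  Equality is propositional equality.
record RealField : Set₁ where
  infixl 6 _+_
  infixl 7 _*_
  infix 4 _≤_ _<_
  field
    Carrier : Set
    _+_ _*_ : Carrier → Carrier → Carrier
    -_      : Carrier → Carrier
    0# 1#   : Carrier
    _≤_     : Carrier → Carrier → Set
    isCommutativeRing : IsCommutativeRing _≡_ _+_ _*_ -_ 0# 1#
    0≢1     : ¬ (0# ≡ 1#)
    inverse : ∀ x → ¬ (x ≡ 0#) → Σ Carrier λ y → x * y ≡ 1#
    isTotalOrder : IsTotalOrder _≡_ _≤_
    +-mono-≤ : ∀ x y z → x ≤ y → x + z ≤ y + z
    *-nonneg : ∀ x y → 0# ≤ x → 0# ≤ y → 0# ≤ x * y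
    complete : (P : Carrier → Set) → Σ Carrier P →
               Σ Carrier (λ b → ∀ x → P x → x ≤ b) →
               Σ Carrier λ s → (∀ x → P x → x ≤ s) ×
                               (∀ b → (∀ x → P x → x ≤ b) → s ≤ b)

  _<_ : Carrier → Carrier → Set
  x < y = x ≤ y × ¬ (x ≡ y)

  fromℕ : ℕ → Carrier
  fromℕ zero    = 0#
  fromℕ (suc n) = 1# + fromℕ n

module Projective (R : RealField) where
  open RealField R

  -- homogeneous coordinates
  record Triple : Set where
    constructor ⟨_,_,_⟩
    field x y z : Carrier
  open Triple

  NonZero : Triple → Set
  NonZero t = ¬ (x t ≡ 0#) ⊎ ¬ (y t ≡ 0#) ⊎ ¬ (z t ≡ 0#)

  -- points and lines of P²(ℝ): nonzero triples, taken up to nonzero scalars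
  record PPoint : Set where
    constructor pt
    field coords : Triple
          nonzero : NonZero coords
  open PPoint public

  PLine : Set
  PLine = PPoint   -- a line is given by its (nonzero) coefficient triple

  scale : Carrier → Triple → Triple
  scale c t = ⟨ c * x t , c * y t , c * z t ⟩

  _≃_ : PPoint → PPoint → Set
  a ≃ b = Σ Carrier λ c → ¬ (c ≡ 0#) × coords a ≡ scale c (coords b)

  dot : Triple → Triple → Carrier
  dot s t = x s * x t + y s * y t + z s * z t

  _∈L_ : PPoint → PLine → Set
  p ∈L ℓ = dot (coords p) (coords ℓ) ≡ 0#

  Collinear : PPoint → PPoint → PPoint → Set
  Collinear a b c = Σ PLine λ ℓ → a ∈L ℓ × b ∈L ℓ × c ∈L ℓ

  record Pencil (n : ℕ) : Set where
    field
      centre   : PPoint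
      line     : Fin n → PLine
      distinct : ∀ i j → line i ≃ line j → i ≡ j
      through  : ∀ i → centre ∈L line i

  GeneralPosition : ∀ {m n} → (Fin m → Pencil n) → Set
  GeneralPosition {m} P = ∀ (i j k : Fin m) → ¬ (i ≡ j) → ¬ (j ≡ k) → ¬ (i ≡ k) →
    ¬ Collinear (Pencil.centre (P i)) (Pencil.centre (P j)) (Pencil.centre (P k))

  Rich : ∀ {m n} → (Fin m → Pencil n) → PPoint → Set
  Rich {m} {n} P q = ∀ (i : Fin m) → Σ (Fin n) λ j → q ∈L Pencil.line (P i) j

  AtLeastRich : ∀ {m n} → (Fin m → Pencil n) → ℕ → Set
  AtLeastRich {m} {n} P K = Σ (Fin K → PPoint) λ f →
    (∀ k → Rich P (f k)) × (∀ k l → f k ≃ f l → k ≡ l)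

module Submission where

open import Defs
open import Data.Nat using (ℕ; _≥_; _^_)
open import Data.Fin using (Fin)
open import Data.Product using (Σ; _×_)
open import Algebra.Bundles using (CommutativeRing)
import Data.Nat as ℕ

-- Put the k-th centre at P_k = (1 : -k : k²), k = 1..m, on the conic
-- y² = xz; no line meets a conic in three points, so the centres are in general position.
-- The line through P_k and a point (x : y : z) has coefficients (-ek, ck - e, c) with
-- e = ky + z and c = kx + y.  Take the s³ grid points (X + a : v : 1 + h), a, v, h < s,
-- where X = n² is a large shift.  For every k the pairs (e, c) they produce satisfy
-- e - 1, c - kX < W = 1 + (m+1)(s-1), so at most W² ≤ n lines of pencil k are needed.
-- The shift X makes the ratio e / c determine (e, c) (fraction-injective), so the n lines
-- of pencil k, indexed via division with remainder by W, are pairwise distinct, and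
-- likewise distinct grid points are projectively distinct.  Choosing s maximal with
-- W² ≤ n gives n ≤ (2(m+1)s)², hence n³ ≤ (8(m+1)³ s³)², and c = 1 / (8(m+1)³) works.

module Arithmetic where

  open import Data.Nat
  open import Data.Nat.Properties
  open import Data.Nat.DivMod
  open import Data.Nat.Tactic.RingSolver using (solve-∀)
  open import Data.Product using (Σ; _×_; _,_)
  open import Data.Empty using (⊥-elim)
  open import Relation.Nullary using (¬_; yes; no)
  open import Relation.Binary.PropositionalEquality
  open import Relation.Binary.Definitions using (tri<; tri≈; tri>)

  -- Cross-multiplied fractions u / (C + r): if u' > u then u·r' = u·r + (u' - u)(C + r) ≥ C,
  -- which is impossible when u·r' < U·w ≤ C.
  fraction-no-smaller : ∀ {U w C u u' r r'} → 1 ≤ u → u ≤ U → r' < w → U * w ≤ C → u < u' →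
                        ¬ (u * (C + r') ≡ u' * (C + r))
  fraction-no-smaller {U} {w} {C} {u} {u'} {r} {r'} 1≤u u≤U r'<w Uw≤C u<u' eq =
    <-irrefl refl (≤-<-trans C≤ur' ur'<C)
    where
    d : ℕ
    d = u' ∸ u
    expand : u * (C + r') ≡ u * C + u * r'
    expand = *-distribˡ-+ u C r'
    expand' : u' * (C + r) ≡ u * C + (u * r + d * (C + r))
    expand' = begin
      u' * (C + r)            ≡⟨ cong (λ t → t * (C + r)) (sym (m+[n∸m]≡n (<⇒≤ u<u'))) ⟩
      (u + d) * (C + r)       ≡⟨ distribute u d C r ⟩
      u * C + (u * r + d * (C + r)) ∎
      where
      open ≡-Reasoning
      distribute : ∀ u d C r → (u + d) * (C + r) ≡ u * C + (u * r + d * (C + r))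
      distribute = solve-∀
    ur'≡ : u * r' ≡ u * r + d * (C + r)
    ur'≡ = +-cancelˡ-≡ (u * C) _ _ (trans (sym expand) (trans eq expand'))
    C≤ur' : C ≤ u * r'
    C≤ur' = begin
      C                       ≤⟨ m≤m+n C r ⟩
      C + r                   ≤⟨ m≤n*m (C + r) d {{>-nonZero (m<n⇒0<n∸m u<u')}} ⟩
      d * (C + r)             ≤⟨ m≤n+m _ (u * r) ⟩
      u * r + d * (C + r)     ≡⟨ sym ur'≡ ⟩
      u * r'                  ∎
      where open ≤-Reasoning
    ur'<C : u * r' < C
    ur'<C = begin-strict
      u * r' <⟨ *-monoʳ-< u {{>-nonZero 1≤u}} r'<w ⟩
      u * w  ≤⟨ *-monoˡ-≤ w u≤U ⟩
      U * w  ≤⟨ Uw≤C ⟩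
      C      ∎
      where open ≤-Reasoning

  fraction-injective : ∀ {U w C u u' r r'} → 1 ≤ u → 1 ≤ u' → u ≤ U → u' ≤ U → r < w → r' < w →
                       U * w ≤ C → u * (C + r') ≡ u' * (C + r) → u ≡ u' × r ≡ r'
  fraction-injective {C = C} {u} {u'} {r} {r'} 1≤u 1≤u' u≤U u'≤U r<w r'<w Uw≤C eq with <-cmp u u'
  ... | tri< u<u' _ _ = ⊥-elim (fraction-no-smaller 1≤u u≤U r'<w Uw≤C u<u' eq)
  ... | tri> _ _ u'<u = ⊥-elim (fraction-no-smaller 1≤u' u'≤U r<w Uw≤C u'<u (sym eq))
  ... | tri≈ _ refl _ = refl , sym (+-cancelˡ-≡ C _ _ (*-cancelˡ-≡ (C + r') (C + r) u {{>-nonZero 1≤u}} eq))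

  divMod-injective : ∀ {t t'} d .{{_ : NonZero d}} → t / d ≡ t' / d → t % d ≡ t' % d → t ≡ t'
  divMod-injective {t} {t'} d q≡ r≡ = begin
    t                    ≡⟨ m≡m%n+[m/n]*n t d ⟩
    t % d + t / d * d    ≡⟨ cong₂ (λ r q → r + q * d) r≡ q≡ ⟩
    t' % d + t' / d * d  ≡⟨ sym (m≡m%n+[m/n]*n t' d) ⟩
    t'                   ∎
    where open ≡-Reasoning

  divMod-encode : ∀ {r d} q .{{_ : NonZero d}} → r < d → (r + q * d) / d ≡ q × (r + q * d) % d ≡ r
  divMod-encode {r} {d} q r<d = quotient , remainder
    where
    remainder : (r + q * d) % d ≡ r
    remainder = trans ([m+kn]%n≡m%n r q d) (m<n⇒m%n≡m r<d)
    no-carry : r % d + (q * d) % d < d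
    no-carry = subst (_< d) (sym (cong₂ _+_ (m<n⇒m%n≡m r<d) (m*n%n≡0 q d))) (subst (_< d) (sym (+-identityʳ r)) r<d)
    quotient : (r + q * d) / d ≡ q
    quotient = trans (+-distrib-/ r (q * d) no-carry) (cong₂ _+_ (m<n⇒m/n≡0 r<d) (m*n/n≡m q d))

  bracket : (f : ℕ → ℕ) → (∀ s → f s < f (suc s)) → ∀ n → f 0 ≤ n → Σ ℕ λ s → f s ≤ n × n < f (suc s)
  bracket f inc zero f0≤0 = 0 , f0≤0 , ≤-<-trans z≤n (inc 0)
  bracket f inc (suc n) f0≤1+n with f 0 ≤? n
  ... | no f0≰n = 0 , f0≤1+n , ≤-<-trans (≰⇒> f0≰n) (inc 0)
  ... | yes f0≤n with bracket f inc n f0≤n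
  ...   | s , fs≤n , n<fs₁ with suc n <? f (suc s)
  ...     | yes 1+n<fs₁ = s , m≤n⇒m≤1+n fs≤n , 1+n<fs₁
  ...     | no 1+n≮fs₁ = suc s , ≮⇒≥ 1+n≮fs₁ , ≤-<-trans n<fs₁ (inc (suc s))

  cube-of-square-bound : ∀ {n a} → n ≤ a * a → n ^ 3 ≤ (a * a * a) * (a * a * a)
  cube-of-square-bound {n} {a} n≤a² = begin
    n ^ 3                          ≡⟨ cong (n *_) (cong (n *_) (*-identityʳ n)) ⟩
    n * (n * n)                    ≤⟨ *-mono-≤ n≤a² (*-mono-≤ n≤a² n≤a²) ⟩
    (a * a) * ((a * a) * (a * a))  ≡⟨ regroup a ⟩
    (a * a * a) * (a * a * a)      ∎
    where
    open ≤-Reasoning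
    regroup : ∀ a → (a * a) * ((a * a) * (a * a)) ≡ (a * a * a) * (a * a * a)
    regroup = solve-∀

  -- With m pencils and grid side s' + 1, the line parameters k·a + b (k ≤ m, a, b ≤ s')
  -- range below line-range m s' = 1 + (m+1)·s'.
  line-range : ℕ → ℕ → ℕ
  line-range m s' = suc (suc m * s')

  -- Grid size: take s maximal with (line-range m s)² ≤ n;
  -- then n < (line-range m (s+1))² ≤ (2(m+1)(s+1))².
  grid-size : ∀ m n → 1 ≤ n → Σ ℕ λ s → line-range m s * line-range m s ≤ n ×
                                        n ≤ (2 * suc m * suc s) * (2 * suc m * suc s)
  grid-size m n 1≤n with bracket square-W square-W-increasing n W₀²≤n
    where
    square-W : ℕ → ℕ
    square-W s = line-range m s * line-range m s
    square-W-increasing : ∀ s → square-W s < square-W (suc s)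
    square-W-increasing s = *-mono-< W-inc W-inc
      where
      W-inc : line-range m s < line-range m (suc s)
      W-inc = s<s (*-monoʳ-< (suc m) (n<1+n s))
    W₀²≤n : square-W 0 ≤ n
    W₀²≤n = subst (_≤ n) (sym (cong (λ t → suc t * suc t) (*-zeroʳ (suc m)))) 1≤n
  ... | s , W²≤n , n<W₁² = s , W²≤n , ≤-trans (<⇒≤ n<W₁²) (*-mono-≤ W₁≤a W₁≤a)
    where
    W₁≤a : line-range m (suc s) ≤ 2 * suc m * suc s
    W₁≤a = begin
      1 + suc m * suc s                ≤⟨ +-monoˡ-≤ (suc m * suc s) (*-mono-≤ (s≤s (z≤n {m})) (s≤s (z≤n {s}))) ⟩
      suc m * suc s + suc m * suc s    ≡⟨ double (suc m) (suc s) ⟩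
      2 * suc m * suc s                ∎
      where
      open ≤-Reasoning
      double : ∀ q t → q * t + q * t ≡ 2 * q * t
      double = solve-∀

  count-bound : ∀ {n} q s → n ≤ (2 * q * s) * (2 * q * s) →
                n ^ 3 ≤ (8 * (q * q * q) * (s * (s * s))) * (8 * (q * q * q) * (s * (s * s)))
  count-bound {n} q s n≤a² = subst (λ b → n ^ 3 ≤ b * b) (cube q s) (cube-of-square-bound {a = 2 * q * s} n≤a²)
    where
    cube : ∀ q s → 2 * q * s * (2 * q * s) * (2 * q * s) ≡ 8 * (q * q * q) * (s * (s * s))
    cube = solve-∀

  slope-bound : ∀ {m s' k a b} → k ≤ m → a < suc s' → b < suc s' → k * a + b < line-range m s'
  slope-bound {m} {s'} {k} {a} {b} k≤m (s≤s a≤s') (s≤s b≤s') = s≤s (begin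
    k * a + b      ≤⟨ +-mono-≤ (*-mono-≤ k≤m a≤s') b≤s' ⟩
    m * s' + s'    ≡⟨ +-comm (m * s') s' ⟩
    suc m * s'     ∎)
    where open ≤-Reasoning

module CubeDigits where

  open import Data.Nat using (ℕ; _*_)
  open import Data.Fin using (Fin; remQuot; combine)
  open import Data.Fin.Properties using (combine-remQuot)
  open import Data.Product using (_×_; _,_; proj₁; proj₂; uncurry)
  open import Relation.Binary.PropositionalEquality

  remQuot-injective : ∀ {m} k {i j : Fin (m * k)} → remQuot {m} k i ≡ remQuot k j → i ≡ j
  remQuot-injective {m} k {i} {j} eq =
    trans (sym (combine-remQuot {m} k i)) (trans (cong (uncurry combine) eq) (combine-remQuot {m} k j))

  digits : ∀ {s} → Fin (s * (s * s)) → Fin s × Fin s × Fin s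
  digits {s} j = proj₁ (remQuot {s} (s * s) j) , remQuot {s} s (proj₂ (remQuot {s} (s * s) j))

  digits-injective : ∀ {s} {j j' : Fin (s * (s * s))} → digits j ≡ digits j' → j ≡ j'
  digits-injective {s} {j} {j'} eq = remQuot-injective {s} (s * s)
    (cong₂ _,_ (cong proj₁ eq) (remQuot-injective {s} s (cong proj₂ eq)))

-- In every commutative ring the
-- canonical map ℤ → R is a ring morphism; instantiating the library's normalising
-- solver with it lets it cancel terms such as x - x, which a solver whose
-- coefficients live in R itself (with no decidable equality) cannot do.
module IntegerCoefficients {c ℓ} (R : CommutativeRing c ℓ) where
  open import Data.Nat as ℕ using (zero; suc)
  import Data.Nat.Properties as ℕ
  open import Data.Integer as ℤ using (ℤ; -[1+_]) renaming (+_ to pos)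
  import Data.Integer.Properties as ℤ
  open import Data.Sign as Sign using (Sign)
  open import Data.Maybe using (Maybe; just; nothing)
  open import Relation.Nullary using (yes; no)
  open import Relation.Binary.PropositionalEquality as Eq using (cong)

  open CommutativeRing R
  open import Algebra.Properties.Semiring.Mult.TCOptimised semiring public using (×-homo-+; ×1-homo-*) renaming (_×_ to _×′_)
  open import Algebra.Properties.Ring ring using (-1*x≈-x; -0#≈0#)
  open import Algebra.Properties.AbelianGroup +-abelianGroup using (⁻¹-∙-comm; ⁻¹-involutive)
  import Algebra.Solver.Ring.AlmostCommutativeRing as ACR
  open import Relation.Binary.Reasoning.Setoid setoid

  ×-suc : ∀ n → suc n ×′ 1# ≈ 1# + n ×′ 1#
  ×-suc n = ×-homo-+ 1# 1 n

  -- small constants are sent to 0#, 1#, - 1# on the nose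
  embed : ℤ → Carrier
  embed (pos n) = n ×′ 1#
  embed (-[1+ n ]) = - (suc n ×′ 1#)

  ⊖-homo : ∀ m n → embed (m ℤ.⊖ n) ≈ m ×′ 1# - n ×′ 1#
  ⊖-homo m zero = sym (trans (+-congˡ -0#≈0#) (+-identityʳ _))
  ⊖-homo zero (suc n) = sym (+-identityˡ _)
  ⊖-homo (suc m) (suc n) = begin
    embed (suc m ℤ.⊖ suc n) ≡⟨ cong embed (ℤ.[1+m]⊖[1+n]≡m⊖n m n) ⟩
    embed (m ℤ.⊖ n) ≈⟨ ⊖-homo m n ⟩
    a + - b ≈⟨ +-congˡ (+-identityˡ (- b)) ⟨
    a + (0# + - b) ≈⟨ +-congˡ (+-congʳ (-‿inverseʳ 1#)) ⟨
    a + ((1# + - 1#) + - b) ≈⟨ +-congˡ (+-assoc _ _ _) ⟩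
    a + (1# + (- 1# + - b)) ≈⟨ +-assoc _ _ _ ⟨
    (a + 1#) + (- 1# + - b) ≈⟨ +-cong (+-comm a 1#) (⁻¹-∙-comm 1# b) ⟩
    (1# + a) + - (1# + b) ≈⟨ +-cong (×-suc m) (-‿cong (×-suc n)) ⟨
    suc m ×′ 1# - suc n ×′ 1# ∎
    where
    a b : Carrier
    a = m ×′ 1#
    b = n ×′ 1#

  +-homo : ∀ i j → embed (i ℤ.+ j) ≈ embed i + embed j
  +-homo (pos m) (pos n) = ×-homo-+ 1# m n
  +-homo (pos m) -[1+ n ] = ⊖-homo m (suc n)
  +-homo -[1+ m ] (pos n) = trans (⊖-homo n (suc m)) (+-comm _ _)
  +-homo -[1+ m ] -[1+ n ] = begin
    - (suc (suc (m ℕ.+ n)) ×′ 1#) ≡⟨ cong (λ t → - (suc t ×′ 1#)) (ℕ.+-suc m n) ⟨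
    - ((suc m ℕ.+ suc n) ×′ 1#) ≈⟨ -‿cong (×-homo-+ 1# (suc m) (suc n)) ⟩
    - (suc m ×′ 1# + suc n ×′ 1#) ≈⟨ ⁻¹-∙-comm _ _ ⟨
    - (suc m ×′ 1#) + - (suc n ×′ 1#) ∎

  -- multiplication goes through the sign/magnitude form embed i = σ (sign i) · ∣i∣
  σ : Sign → Carrier
  σ Sign.+ = 1#
  σ Sign.- = - 1#

  σ-homo : ∀ s t → σ (s Sign.* t) ≈ σ s * σ t
  σ-homo Sign.- Sign.- = sym (trans (-1*x≈-x (- 1#)) (⁻¹-involutive 1#))
  σ-homo Sign.- Sign.+ = sym (*-identityʳ _)
  σ-homo Sign.+ Sign.- = sym (*-identityˡ _)
  σ-homo Sign.+ Sign.+ = sym (*-identityˡ _)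

  ◃-homo : ∀ s n → embed (s ℤ.◃ n) ≈ σ s * (n ×′ 1#)
  ◃-homo s zero = sym (zeroʳ _)
  ◃-homo Sign.+ (suc n) = sym (*-identityˡ _)
  ◃-homo Sign.- (suc n) = sym (-1*x≈-x _)

  sign-magnitude : ∀ i → embed i ≈ σ (ℤ.sign i) * (ℤ.∣ i ∣ ×′ 1#)
  sign-magnitude i = trans (reflexive (cong embed (Eq.sym (ℤ.◃-inverse i)))) (◃-homo (ℤ.sign i) ℤ.∣ i ∣)

  interchange : ∀ p q u v → (p * q) * (u * v) ≈ (p * u) * (q * v)
  interchange p q u v = begin
    (p * q) * (u * v) ≈⟨ *-assoc p q (u * v) ⟩
    p * (q * (u * v)) ≈⟨ *-congˡ (*-assoc q u v) ⟨
    p * ((q * u) * v) ≈⟨ *-congˡ (*-congʳ (*-comm q u)) ⟩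
    p * ((u * q) * v) ≈⟨ *-congˡ (*-assoc u q v) ⟩
    p * (u * (q * v)) ≈⟨ *-assoc p u (q * v) ⟨
    (p * u) * (q * v) ∎

  *-homo : ∀ i j → embed (i ℤ.* j) ≈ embed i * embed j
  *-homo i j = begin
    embed (i ℤ.* j) ≈⟨ ◃-homo (s Sign.* t) (a ℕ.* b) ⟩
    σ (s Sign.* t) * ((a ℕ.* b) ×′ 1#) ≈⟨ *-cong (σ-homo s t) (×1-homo-* a b) ⟩
    (σ s * σ t) * ((a ×′ 1#) * (b ×′ 1#)) ≈⟨ interchange (σ s) (σ t) (a ×′ 1#) (b ×′ 1#) ⟩
    (σ s * (a ×′ 1#)) * (σ t * (b ×′ 1#)) ≈⟨ *-cong (sign-magnitude i) (sign-magnitude j) ⟨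
    embed i * embed j ∎
    where
    s t : Sign
    s = ℤ.sign i
    t = ℤ.sign j
    a b : ℕ.ℕ
    a = ℤ.∣ i ∣
    b = ℤ.∣ j ∣

  -‿homo : ∀ i → embed (ℤ.- i) ≈ - embed i
  -‿homo -[1+ n ] = sym (⁻¹-involutive _)
  -‿homo (pos zero) = sym -0#≈0#
  -‿homo (pos (suc n)) = refl

  almostRing : ACR.AlmostCommutativeRing c ℓ
  almostRing = ACR.fromCommutativeRing R

  morphism : ACR._-Raw-AlmostCommutative⟶_ ℤ.+-*-rawRing almostRing
  morphism = record
    { ⟦_⟧ = embed ; +-homo = +-homo ; *-homo = *-homo ; -‿homo = -‿homo
    ; 0-homo = refl ; 1-homo = refl }

  equal? : ∀ i j → Maybe (embed i ≈ embed j)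
  equal? i j with i ℤ.≟ j
  ... | yes i≡j = just (reflexive (cong embed i≡j))
  ... | no _ = nothing

  open import Algebra.Solver.Ring ℤ.+-*-rawRing almostRing morphism equal? public

module OrderedField (R : RealField) where
  open import Level using (0ℓ)
  open import Relation.Binary.Structures using (IsTotalOrder)
  open import Data.Nat as ℕ using (zero; suc)
  import Data.Nat.Properties as ℕ
  open import Data.Integer using () renaming (+_ to pos)
  open import Data.Product using (Σ; _×_; _,_)
  open import Data.Sum using (inj₁; inj₂)
  open import Data.Empty using (⊥-elim)
  open import Relation.Nullary using (¬_; contradiction)
  open import Relation.Binary.Definitions using (tri<; tri≈; tri>)
  open import Relation.Binary.PropositionalEquality
  open RealField R

  ring : CommutativeRing 0ℓ 0ℓ
  ring = record { isCommutativeRing = isCommutativeRing }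

  open CommutativeRing ring public using (_-_)
  open CommutativeRing ring using (zeroʳ; *-identityʳ)
  open IntegerCoefficients ring public using (solve; _:=_; _:+_; _:-_; _:*_; :-_; con)
  open IntegerCoefficients ring using (_×′_; ×-suc; ×-homo-+; ×1-homo-*)
  open import Algebra.Properties.AbelianGroup (CommutativeRing.+-abelianGroup ring) using (x∙y⁻¹≈ε⇒x≈y; ⁻¹-involutive)
  open import Algebra.Properties.Ring (CommutativeRing.ring ring) using (-0#≈0#)
  module ≤ = IsTotalOrder isTotalOrder

  0≤-⇒≤ : ∀ {x y} → 0# ≤ y - x → x ≤ y
  0≤-⇒≤ {x} {y} 0≤y-x = subst₂ _≤_ (solve 1 (λ x → con (pos 0) :+ x := x) refl x)
                                  (solve 2 (λ x y → (y :- x) :+ x := y) refl x y)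
                                  (+-mono-≤ 0# (y - x) x 0≤y-x)

  ≤⇒0≤- : ∀ {x y} → x ≤ y → 0# ≤ y - x
  ≤⇒0≤- {x} {y} x≤y = subst (_≤ y - x) (solve 1 (λ x → x :- x := con (pos 0)) refl x)
                              (+-mono-≤ x y (- x) x≤y)

  -- 1 is positive, being a square: otherwise 0 ≤ -1 and then 0 ≤ (-1)² = 1 anyway
  0≤1 : 0# ≤ 1#
  0≤1 with ≤.total 0# 1#
  ... | inj₁ 0≤1 = 0≤1
  ... | inj₂ 1≤0 = subst (0# ≤_) (solve 0 ((:- con (pos 1)) :* (:- con (pos 1)) := con (pos 1)) refl)
                         (*-nonneg (- 1#) (- 1#) 0≤-1 0≤-1)
    where
    0≤-1 : 0# ≤ - 1#
    0≤-1 = subst (0# ≤_) (solve 0 (con (pos 0) :- con (pos 1) := :- con (pos 1)) refl) (≤⇒0≤- 1≤0)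

  0≤+ : ∀ {a b} → 0# ≤ a → 0# ≤ b → 0# ≤ a + b
  0≤+ {a} {b} 0≤a 0≤b = ≤.trans 0≤a (0≤-⇒≤ (subst (0# ≤_) (solve 2 (λ a b → b := (a :+ b) :- a) refl a b) 0≤b))

  *-monoˡ-≤ : ∀ {x y z} → 0# ≤ z → x ≤ y → z * x ≤ z * y
  *-monoˡ-≤ {x} {y} {z} 0≤z x≤y = 0≤-⇒≤ (subst (0# ≤_) (solve 3 (λ x y z → z :* (y :- x) := z :* y :- z :* x) refl x y z)
                                                (*-nonneg z (y - x) 0≤z (≤⇒0≤- x≤y)))

  -≡0⇒≡ : ∀ {x y} → x - y ≡ 0# → x ≡ y
  -≡0⇒≡ = x∙y⁻¹≈ε⇒x≈y _ _

  -≡0⇒≡0 : ∀ {x} → - x ≡ 0# → x ≡ 0#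
  -≡0⇒≡0 {x} -x≡0 = trans (sym (⁻¹-involutive x)) (trans (cong -_ -x≡0) -0#≈0#)

  cancel : ∀ {x y} → ¬ (x ≡ 0#) → x * y ≡ 0# → y ≡ 0#
  cancel {x} {y} x≢0 xy≡0 with inverse x x≢0
  ... | x⁻¹ , xx⁻¹≡1 = begin
    y                  ≡⟨ sym (*-identityʳ y) ⟩
    y * 1#             ≡⟨ cong (y *_) (sym xx⁻¹≡1) ⟩
    y * (x * x⁻¹)      ≡⟨ solve 3 (λ x y x⁻¹ → y :* (x :* x⁻¹) := x⁻¹ :* (x :* y)) refl x y x⁻¹ ⟩
    x⁻¹ * (x * y)      ≡⟨ cong (x⁻¹ *_) xy≡0 ⟩
    x⁻¹ * 0#           ≡⟨ zeroʳ x⁻¹ ⟩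
    0#                 ∎
    where open ≡-Reasoning

  fromℕ≡× : ∀ n → fromℕ n ≡ n ×′ 1#
  fromℕ≡× zero = refl
  fromℕ≡× (suc n) = trans (cong (1# +_) (fromℕ≡× n)) (sym (×-suc n))

  fromℕ-+ : ∀ a b → fromℕ (a ℕ.+ b) ≡ fromℕ a + fromℕ b
  fromℕ-+ a b = trans (fromℕ≡× (a ℕ.+ b))
    (trans (×-homo-+ 1# a b) (sym (cong₂ _+_ (fromℕ≡× a) (fromℕ≡× b))))

  fromℕ-* : ∀ a b → fromℕ (a ℕ.* b) ≡ fromℕ a * fromℕ b
  fromℕ-* a b = trans (fromℕ≡× (a ℕ.* b))
    (trans (×1-homo-* a b) (sym (cong₂ _*_ (fromℕ≡× a) (fromℕ≡× b))))

  0≤fromℕ : ∀ n → 0# ≤ fromℕ n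
  0≤fromℕ zero = ≤.refl
  0≤fromℕ (suc n) = 0≤+ 0≤1 (0≤fromℕ n)

  fromℕ-suc≢0 : ∀ n → ¬ (fromℕ (suc n) ≡ 0#)
  fromℕ-suc≢0 n 1+n≡0 = 0≢1 (≤.antisym 0≤1 (subst (1# ≤_) 1+n≡0 1≤1+n))
    where
    1≤1+n : 1# ≤ 1# + fromℕ n
    1≤1+n = 0≤-⇒≤ (subst (0# ≤_) (solve 1 (λ a → a := (con (pos 1) :+ a) :- con (pos 1)) refl (fromℕ n)) (0≤fromℕ n))

  fromℕ-nonzero : ∀ {n} → 1 ℕ.≤ n → ¬ (fromℕ n ≡ 0#)
  fromℕ-nonzero {suc n} _ = fromℕ-suc≢0 n

  fromℕ-∸ : ∀ {a b} → a ℕ.≤ b → fromℕ b - fromℕ a ≡ fromℕ (b ℕ.∸ a)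
  fromℕ-∸ {a} {b} a≤b = begin
    fromℕ b - fromℕ a                     ≡⟨ cong (λ t → fromℕ t - fromℕ a) (sym (ℕ.m+[n∸m]≡n a≤b)) ⟩
    fromℕ (a ℕ.+ (b ℕ.∸ a)) - fromℕ a     ≡⟨ cong (_- fromℕ a) (fromℕ-+ a (b ℕ.∸ a)) ⟩
    (fromℕ a + fromℕ (b ℕ.∸ a)) - fromℕ a ≡⟨ solve 2 (λ a d → (a :+ d) :- a := d) refl (fromℕ a) (fromℕ (b ℕ.∸ a)) ⟩
    fromℕ (b ℕ.∸ a)                       ∎
    where open ≡-Reasoning

  fromℕ-mono : ∀ {a b} → a ℕ.≤ b → fromℕ a ≤ fromℕ b
  fromℕ-mono {a} {b} a≤b = 0≤-⇒≤ (subst (0# ≤_) (sym (fromℕ-∸ a≤b)) (0≤fromℕ (b ℕ.∸ a)))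

  -- distinct naturals have distinct images: their gap is a nonzero image
  fromℕ-<⇒≢ : ∀ {a b} → a ℕ.< b → ¬ (fromℕ b ≡ fromℕ a)
  fromℕ-<⇒≢ {a} {b} a<b eq = fromℕ-nonzero (ℕ.m<n⇒0<n∸m a<b) (begin
    fromℕ (b ℕ.∸ a)       ≡⟨ sym (fromℕ-∸ (ℕ.<⇒≤ a<b)) ⟩
    fromℕ b - fromℕ a     ≡⟨ cong (_- fromℕ a) eq ⟩
    fromℕ a - fromℕ a     ≡⟨ solve 1 (λ a → a :- a := con (pos 0)) refl (fromℕ a) ⟩
    0#                    ∎)
    where open ≡-Reasoning

  fromℕ-injective : ∀ {a b} → fromℕ a ≡ fromℕ b → a ≡ b
  fromℕ-injective {a} {b} eq with ℕ.<-cmp a b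
  ... | tri< a<b _ _ = contradiction (sym eq) (fromℕ-<⇒≢ a<b)
  ... | tri≈ _ a≡b _ = a≡b
  ... | tri> _ _ b<a = contradiction eq (fromℕ-<⇒≢ b<a)

  positive-reciprocal : ∀ {d} → 1 ℕ.≤ d → Σ Carrier λ c → 0# < c × fromℕ d * c ≡ 1#
  positive-reciprocal {d} 1≤d with inverse (fromℕ d) (fromℕ-nonzero 1≤d)
  ... | c , Dc≡1 = c , (0≤c , 0≢c) , Dc≡1
    where
    D : Carrier
    D = fromℕ d
    0≢c : ¬ (0# ≡ c)
    0≢c 0≡c = 0≢1 (trans (sym (zeroʳ D)) (trans (cong (D *_) 0≡c) Dc≡1))
    0≤c : 0# ≤ c
    0≤c with ≤.total 0# c
    ... | inj₁ 0≤c = 0≤c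
    ... | inj₂ c≤0 = ⊥-elim (0≢1 (≤.antisym 0≤1 (0≤-⇒≤ 0≤0-1)))
      where
      0≤D·-c : 0# ≤ D * (0# - c)
      0≤D·-c = *-nonneg D (0# - c) (0≤fromℕ d) (≤⇒0≤- c≤0)
      0≤0-1 : 0# ≤ 0# - 1#
      0≤0-1 = subst (0# ≤_) (trans (solve 2 (λ D c → D :* (con (pos 0) :- c) := con (pos 0) :- D :* c) refl D c)
                                   (cong (λ t → 0# - t) Dc≡1)) 0≤D·-c

  reciprocal-bound : ∀ {d} → 1 ℕ.≤ d → Σ Carrier λ c → 0# < c ×
    (∀ a k → a ℕ.≤ (d ℕ.* k) ℕ.* (d ℕ.* k) → c * c * fromℕ a ≤ fromℕ k * fromℕ k)
  reciprocal-bound {d} 1≤d with positive-reciprocal 1≤d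
  ... | c , 0<c@(0≤c , _) , Dc≡1 = c , 0<c , bound
    where
    D : Carrier
    D = fromℕ d
    bound : ∀ a k → a ℕ.≤ (d ℕ.* k) ℕ.* (d ℕ.* k) → c * c * fromℕ a ≤ fromℕ k * fromℕ k
    bound a k a≤ = subst (c * c * fromℕ a ≤_) scaled (*-monoˡ-≤ (*-nonneg c c 0≤c 0≤c) (fromℕ-mono a≤))
      where
      open ≡-Reasoning
      K : Carrier
      K = fromℕ k
      scaled : c * c * fromℕ ((d ℕ.* k) ℕ.* (d ℕ.* k)) ≡ K * K
      scaled = begin
        c * c * fromℕ ((d ℕ.* k) ℕ.* (d ℕ.* k))
          ≡⟨ cong (c * c *_) (trans (fromℕ-* (d ℕ.* k) (d ℕ.* k)) (cong₂ _*_ (fromℕ-* d k) (fromℕ-* d k))) ⟩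
        c * c * ((D * K) * (D * K))
          ≡⟨ solve 3 (λ c D K → c :* c :* ((D :* K) :* (D :* K)) := (D :* c) :* (D :* c) :* (K :* K)) refl c D K ⟩
        (D * c) * (D * c) * (K * K)
          ≡⟨ cong (λ t → t * t * (K * K)) Dc≡1 ⟩
        1# * 1# * (K * K)
          ≡⟨ solve 1 (λ K → con (pos 1) :* con (pos 1) :* (K :* K) := K :* K) refl K ⟩
        K * K ∎

  ≢⇒-≢0 : ∀ {x y} → ¬ (x ≡ y) → ¬ (x - y ≡ 0#)
  ≢⇒-≢0 x≢y x-y≡0 = x≢y (-≡0⇒≡ x-y≡0)

  quadratic : Carrier → Carrier → Carrier → Carrier → Carrier
  quadratic a b c t = a + b * t + c * (t * t)

  three-roots : ∀ {a b c p q r} → ¬ (p ≡ q) → ¬ (q ≡ r) → ¬ (p ≡ r) →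
    quadratic a b c p ≡ 0# → quadratic a b c q ≡ 0# → quadratic a b c r ≡ 0# →
    a ≡ 0# × b ≡ 0# × c ≡ 0#
  three-roots {a} {b} {c} {p} {q} {r} p≢q q≢r p≢r fp fq fr = a≡0 , b≡0 , c≡0
    where
    open ≡-Reasoning
    -- f s - f t = (s - t)(b + c (s + t)), so a vanishing difference at s ≠ t kills the second factor
    secant : ∀ {s t} → ¬ (s ≡ t) → quadratic a b c s ≡ 0# → quadratic a b c t ≡ 0# → b + c * (s + t) ≡ 0#
    secant {s} {t} s≢t fs ft = cancel (≢⇒-≢0 s≢t) (begin
      (s - t) * (b + c * (s + t))                  ≡⟨ solve 5 (λ a b c s t →
          (s :- t) :* (b :+ c :* (s :+ t)) := (a :+ b :* s :+ c :* (s :* s)) :- (a :+ b :* t :+ c :* (t :* t))) refl a b c s t ⟩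
      quadratic a b c s - quadratic a b c t        ≡⟨ cong₂ _-_ fs ft ⟩
      0# - 0#                                      ≡⟨ solve 0 (con (pos 0) :- con (pos 0) := con (pos 0)) refl ⟩
      0#                                           ∎)
    c≡0 : c ≡ 0#
    c≡0 = cancel (≢⇒-≢0 q≢r) (begin
      (q - r) * c                                   ≡⟨ solve 5 (λ b c p q r →
          (q :- r) :* c := (b :+ c :* (p :+ q)) :- (b :+ c :* (p :+ r))) refl b c p q r ⟩
      (b + c * (p + q)) - (b + c * (p + r))         ≡⟨ cong₂ _-_ (secant p≢q fp fq) (secant p≢r fp fr) ⟩
      0# - 0#                                       ≡⟨ solve 0 (con (pos 0) :- con (pos 0) := con (pos 0)) refl ⟩
      0#                                            ∎)
    b≡0 : b ≡ 0#
    b≡0 = begin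
      b                   ≡⟨ solve 4 (λ b c p q → b := b :+ c :* (p :+ q) :- c :* (p :+ q)) refl b c p q ⟩
      b + c * (p + q) - c * (p + q) ≡⟨ cong₂ (λ u v → u - v * (p + q)) (secant p≢q fp fq) c≡0 ⟩
      0# - 0# * (p + q)   ≡⟨ solve 2 (λ p q → con (pos 0) :- con (pos 0) :* (p :+ q) := con (pos 0)) refl p q ⟩
      0#                  ∎
    a≡0 : a ≡ 0#
    a≡0 = begin
      a                       ≡⟨ solve 4 (λ a b c p → a := (a :+ b :* p :+ c :* (p :* p)) :- b :* p :- c :* (p :* p)) refl a b c p ⟩
      quadratic a b c p - b * p - c * (p * p)  ≡⟨ cong (λ u → u - b * p - c * (p * p)) fp ⟩
      0# - b * p - c * (p * p)  ≡⟨ cong₂ (λ u v → 0# - u * p - v * (p * p)) b≡0 c≡0 ⟩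
      0# - 0# * p - 0# * (p * p) ≡⟨ solve 1 (λ p → con (pos 0) :- con (pos 0) :* p :- con (pos 0) :* (p :* p) := con (pos 0)) refl p ⟩
      0#                      ∎

module PencilGeometry (R : RealField) where
  open import Data.Integer using () renaming (+_ to pos)
  open import Data.Product using (_×_; _,_)
  open import Data.Sum using (inj₁; inj₂)
  open import Data.Empty using (⊥)
  open import Relation.Nullary using (¬_)
  open import Relation.Binary.PropositionalEquality
  open RealField R
  open Projective R
  open OrderedField R
  open Triple

  -- the centre (1 : -k : k²), a point of the conic y² = xz
  centreT : Carrier → Triple
  centreT k = ⟨ 1# , - k , k * k ⟩

  lineT : Carrier → Carrier → Carrier → Triple
  lineT k e c = ⟨ - (e * k) , c * k - e , c ⟩

  centre-on-line : ∀ k e c → dot (centreT k) (lineT k e c) ≡ 0#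
  centre-on-line = solve 3 (λ k e c →
    con (pos 1) :* (:- (e :* k)) :+ (:- k) :* (c :* k :- e) :+ (k :* k) :* c := con (pos 0)) refl

  point-on-line : ∀ k x y z → dot ⟨ x , y , z ⟩ (lineT k (k * y + z) (k * x + y)) ≡ 0#
  point-on-line = solve 4 (λ k x y z →
    x :* (:- ((k :* y :+ z) :* k)) :+ y :* ((k :* x :+ y) :* k :- (k :* y :+ z)) :+ z :* (k :* x :+ y)
      := con (pos 0)) refl

  cross-multiply : ∀ {a a' b b' l} → a ≡ l * a' → b ≡ l * b' → a * b' ≡ a' * b
  cross-multiply {a} {a'} {b} {b'} {l} a≡la' b≡lb' = begin
    a * b'         ≡⟨ cong (_* b') a≡la' ⟩
    (l * a') * b'  ≡⟨ solve 3 (λ l a' b' → (l :* a') :* b' := a' :* (l :* b')) refl l a' b' ⟩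
    a' * (l * b')  ≡⟨ cong (a' *_) (sym b≡lb') ⟩
    a' * b         ∎
    where open ≡-Reasoning

  lines-proportional : ∀ {k e c e' c' l} → lineT k e c ≡ scale l (lineT k e' c') → e * c' ≡ e' * c
  lines-proportional {k} {e} {c} {e'} {c'} {l} eq = cross-multiply e≡le' c≡lc'
    where
    open ≡-Reasoning
    c≡lc' : c ≡ l * c'
    c≡lc' = cong z eq
    e≡le' : e ≡ l * e'
    e≡le' = begin
      e                                ≡⟨ solve 3 (λ c k e → e := c :* k :- (c :* k :- e)) refl c k e ⟩
      c * k - (c * k - e)              ≡⟨ cong₂ (λ u v → u * k - v) c≡lc' (cong y eq) ⟩
      (l * c') * k - l * (c' * k - e') ≡⟨ solve 4 (λ l c' k e' → (l :* c') :* k :- l :* (c' :* k :- e') := l :* e') refl l c' k e' ⟩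
      l * e'                           ∎

  points-proportional : ∀ {p p' : Triple} {l} → p ≡ scale l p' →
    z p * x p' ≡ z p' * x p × x p * y p' ≡ x p' * y p
  points-proportional eq = cross-multiply (cong z eq) (cong x eq) , cross-multiply (cong x eq) (cong y eq)

  centre-incidence : ∀ t a b c → dot (centreT t) ⟨ a , b , c ⟩ ≡ quadratic a (- b) c t
  centre-incidence = solve 4 (λ t a b c →
    con (pos 1) :* a :+ (:- t) :* b :+ (t :* t) :* c := a :+ (:- b) :* t :+ c :* (t :* t)) refl

  -- no line meets the conic in three points: the centres are in general position
  centres-not-collinear : ∀ {p q r} → ¬ (p ≡ q) → ¬ (q ≡ r) → ¬ (p ≡ r) →
    (ℓ : PLine) → dot (centreT p) (coords ℓ) ≡ 0# → dot (centreT q) (coords ℓ) ≡ 0# →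
    dot (centreT r) (coords ℓ) ≡ 0# → ⊥
  centres-not-collinear {p} {q} {r} p≢q q≢r p≢r (pt ⟨ a , b , c ⟩ ℓ≢0) onp onq onr =
    all-zero ℓ≢0 (three-roots p≢q q≢r p≢r (root p onp) (root q onq) (root r onr))
    where
    root : ∀ t → dot (centreT t) ⟨ a , b , c ⟩ ≡ 0# → quadratic a (- b) c t ≡ 0#
    root t = trans (sym (centre-incidence t a b c))
    all-zero : NonZero ⟨ a , b , c ⟩ → a ≡ 0# × - b ≡ 0# × c ≡ 0# → ⊥
    all-zero (inj₁ a≢0) (a≡0 , _) = a≢0 a≡0
    all-zero (inj₂ (inj₁ b≢0)) (_ , -b≡0 , _) = b≢0 (-≡0⇒≡0 -b≡0)
    all-zero (inj₂ (inj₂ c≢0)) (_ , _ , c≡0) = c≢0 c≡0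

-- The configuration for grid side s = s' + 1, given W² ≤ n for W = line-range m s':
-- m n-pencils with centres in general position sharing s³ rich points.
module Construction (R : RealField) (m n s' : ℕ)
    (W²≤n : Arithmetic.line-range m s' ℕ.* Arithmetic.line-range m s' ℕ.≤ n) where
  open import Data.Nat as ℕ using (suc; s≤s; z≤n; _/_; _%_)
  import Data.Nat.Properties as ℕ
  open import Data.Nat.DivMod using (m%n<n; m/n≤m)
  open import Data.Fin using (toℕ; fromℕ<)
  import Data.Fin.Properties as Fin
  open import Data.Product using (_×_; _,_; proj₁; proj₂)
  open import Data.Sum using (inj₁; inj₂)
  open import Relation.Nullary using (¬_)
  open import Relation.Binary.PropositionalEquality
  open import Function using (_∘_)
  open import Data.Nat.Tactic.RingSolver using (solve-∀)
  open Arithmetic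
  open CubeDigits
  open RealField R
  open Projective R
  open OrderedField R
  open PencilGeometry R

  s W X : ℕ
  s = suc s'
  W = line-range m s'
  -- a large offset making line parameters and grid points separable (see fraction-injective)
  X = n ℕ.* n

  W≤n : W ℕ.≤ n
  W≤n = ℕ.≤-trans (ℕ.m≤m*n W W) W²≤n

  1≤n : 1 ℕ.≤ n
  1≤n = ℕ.≤-trans (s≤s z≤n) W≤n

  fromℕ-affine : ∀ k x y → fromℕ (k ℕ.* x ℕ.+ y) ≡ fromℕ k * fromℕ x + fromℕ y
  fromℕ-affine k x y = trans (fromℕ-+ (k ℕ.* x) y) (cong (_+ fromℕ y) (fromℕ-* k x))

  cross-in-ℕ : ∀ a b c d → fromℕ a * fromℕ b ≡ fromℕ c * fromℕ d → a ℕ.* b ≡ c ℕ.* d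
  cross-in-ℕ a b c d eq = fromℕ-injective (trans (fromℕ-* a b) (trans eq (sym (fromℕ-* c d))))

  instance
    n≢0 : ℕ.NonZero n
    n≢0 = ℕ.>-nonZero 1≤n

  1≤X : 1 ℕ.≤ X
  1≤X = ℕ.*-mono-≤ 1≤n 1≤n

  s≤W : s ℕ.≤ W
  s≤W = s≤s (ℕ.m≤m+n s' (m ℕ.* s'))

  s²≤X : s ℕ.* s ℕ.≤ X
  s²≤X = ℕ.≤-trans (ℕ.*-mono-≤ s≤W s≤W) (ℕ.≤-trans W²≤n (ℕ.m≤m*n n n))

  centre : ℕ → PPoint
  centre k = pt (centreT (fromℕ k)) (inj₁ (λ 1≡0 → 0≢1 (sym 1≡0)))

  lineE : ℕ → ℕ
  lineE t = suc (t / W)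

  lineC : ℕ → ℕ → ℕ
  lineC k t = k ℕ.* X ℕ.+ t % W

  -- its third coefficient c ≥ k·X is nonzero
  pencil-line : (k : ℕ) .{{_ : ℕ.NonZero k}} → ℕ → PLine
  pencil-line k t = pt (lineT (fromℕ k) (fromℕ (lineE t)) (fromℕ (lineC k t)))
    (inj₂ (inj₂ (fromℕ-nonzero (ℕ.≤-trans 1≤X (ℕ.≤-trans (ℕ.m≤n*m X k) (ℕ.m≤m+n _ _))))))

  -- indices below n give projectively distinct lines: (e, c) is recovered from e / c
  pencil-line-injective : ∀ k .{{_ : ℕ.NonZero k}} {t t'} → t ℕ.< n → t' ℕ.< n →
                          pencil-line k t ≃ pencil-line k t' → t ≡ t'
  pencil-line-injective k {t} {t'} t<n t'<n (l , _ , eq) =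
    divMod-injective W (ℕ.suc-injective (proj₁ e≡e'×r≡r')) (proj₂ e≡e'×r≡r')
    where
    e≤n : ∀ {t} → t ℕ.< n → lineE t ℕ.≤ n
    e≤n {t} t<n = ℕ.≤-<-trans (m/n≤m t W) t<n
    nW≤kX : n ℕ.* W ℕ.≤ k ℕ.* X
    nW≤kX = ℕ.≤-trans (ℕ.*-monoʳ-≤ n W≤n) (ℕ.m≤n*m X k)
    cross : lineE t ℕ.* lineC k t' ≡ lineE t' ℕ.* lineC k t
    cross = cross-in-ℕ (lineE t) (lineC k t') (lineE t') (lineC k t) (lines-proportional eq)
    e≡e'×r≡r' : lineE t ≡ lineE t' × t % W ≡ t' % W
    e≡e'×r≡r' = fraction-injective (s≤s z≤n) (s≤s z≤n) (e≤n t<n) (e≤n t'<n) (m%n<n t W) (m%n<n t' W) nW≤kX cross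

  pencil : Fin m → Pencil n
  pencil i = record
    { centre   = centre k
    ; line     = λ j → pencil-line k (toℕ j)
    ; distinct = λ j j' ≃ → Fin.toℕ-injective (pencil-line-injective k (Fin.toℕ<n j) (Fin.toℕ<n j') ≃)
    ; through  = λ j → centre-on-line _ _ _
    }
    where
    k : ℕ
    k = suc (toℕ i)

  general-position : GeneralPosition pencil
  general-position i j k i≢j j≢k i≢k (ℓ , on-i , on-j , on-k) =
    centres-not-collinear (distinct-centres i≢j) (distinct-centres j≢k) (distinct-centres i≢k) ℓ on-i on-j on-k
    where
    distinct-centres : ∀ {i j : Fin m} → ¬ i ≡ j → ¬ fromℕ (suc (toℕ i)) ≡ fromℕ (suc (toℕ j))
    distinct-centres i≢j eq = i≢j (Fin.toℕ-injective (ℕ.suc-injective (fromℕ-injective eq)))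

  grid-point : ℕ → ℕ → ℕ → PPoint
  grid-point a v h = pt ⟨ fromℕ (X ℕ.+ a) , fromℕ v , fromℕ (suc h) ⟩ (inj₂ (inj₂ (fromℕ-suc≢0 h)))

  -- grid points with a, h < s are projectively distinct: z / x determines (h, a), then y / x gives v
  grid-point-injective : ∀ {a v h a' v' h'} → a ℕ.< s → h ℕ.< s → a' ℕ.< s → h' ℕ.< s →
    grid-point a v h ≃ grid-point a' v' h' → a ≡ a' × v ≡ v' × h ≡ h'
  grid-point-injective {a} {v} {h} {a'} {v'} {h'} a<s h<s a'<s h'<s (l , _ , eq) =
    proj₂ h≡h'×a≡a' , v≡v' , ℕ.suc-injective (proj₁ h≡h'×a≡a')
    where
    x x' : ℕ
    x = X ℕ.+ a
    x' = X ℕ.+ a'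
    h≡h'×a≡a' : suc h ≡ suc h' × a ≡ a'
    h≡h'×a≡a' = fraction-injective (s≤s z≤n) (s≤s z≤n) h<s h'<s a<s a'<s s²≤X
      (cross-in-ℕ (suc h) x' (suc h') x (proj₁ (points-proportional eq)))
    xv'≡xv : x ℕ.* v' ≡ x ℕ.* v
    xv'≡xv = trans (cross-in-ℕ x v' x' v (proj₂ (points-proportional eq)))
                   (cong (λ u → (X ℕ.+ u) ℕ.* v) (sym (proj₂ h≡h'×a≡a')))
    v≡v' : v ≡ v'
    v≡v' = sym (ℕ.*-cancelˡ-≡ v' v x {{ℕ.>-nonZero (ℕ.≤-trans 1≤X (ℕ.m≤m+n X a))}} xv'≡xv)

  digit-point : Fin s × Fin s × Fin s → PPoint
  digit-point (a , v , h) = grid-point (toℕ a) (toℕ v) (toℕ h)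

  digit-point-injective : ∀ {d d'} → digit-point d ≃ digit-point d' → d ≡ d'
  digit-point-injective {a , v , h} {a' , v' , h'} ≃ =
    cong₂ _,_ (Fin.toℕ-injective a≡a') (cong₂ _,_ (Fin.toℕ-injective v≡v') (Fin.toℕ-injective h≡h'))
    where
    equal-digits : toℕ a ≡ toℕ a' × toℕ v ≡ toℕ v' × toℕ h ≡ toℕ h'
    equal-digits = grid-point-injective (Fin.toℕ<n a) (Fin.toℕ<n h) (Fin.toℕ<n a') (Fin.toℕ<n h') ≃
    a≡a' : toℕ a ≡ toℕ a'
    a≡a' = proj₁ equal-digits
    v≡v' : toℕ v ≡ toℕ v'
    v≡v' = proj₁ (proj₂ equal-digits)
    h≡h' : toℕ h ≡ toℕ h'
    h≡h' = proj₂ (proj₂ equal-digits)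

  rich-point : Fin (s ℕ.* (s ℕ.* s)) → PPoint
  rich-point j = digit-point (digits j)

  rich-point-injective : ∀ j j' → rich-point j ≃ rich-point j' → j ≡ j'
  rich-point-injective j j' ≃ = digits-injective (digit-point-injective ≃)

  -- the index of the line of pencil k through the grid point (a, v, h): its parameters are
  -- e = k·v + (1 + h) and c = k·(X + a) + v, as point-on-line requires
  line-index : ℕ → ℕ → ℕ → ℕ → ℕ
  line-index k a v h = (k ℕ.* a ℕ.+ v) ℕ.+ (k ℕ.* v ℕ.+ h) ℕ.* W

  -- the index is below W² ≤ n, since both digits k·a + v and k·v + h are below W
  line-index<n : ∀ {k a v h} → k ℕ.≤ m → a ℕ.< s → v ℕ.< s → h ℕ.< s → line-index k a v h ℕ.< n
  line-index<n k≤m a<s v<s h<s =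
    ℕ.≤-trans (ℕ.+-mono-≤ (slope-bound k≤m a<s v<s) (ℕ.*-monoˡ-≤ W (ℕ.s≤s⁻¹ (slope-bound k≤m v<s h<s)))) W²≤n

  grid-point-on-line : ∀ k .{{_ : ℕ.NonZero k}} {a v h} → k ℕ.≤ m → a ℕ.< s → v ℕ.< s → h ℕ.< s →
                       grid-point a v h ∈L pencil-line k (line-index k a v h)
  grid-point-on-line k {a} {v} {h} k≤m a<s v<s h<s =
    subst₂ (λ e c → dot P (lineT (fromℕ k) e c) ≡ 0#) (sym e≡) (sym c≡)
           (point-on-line (fromℕ k) (fromℕ (X ℕ.+ a)) (fromℕ v) (fromℕ (suc h)))
    where
    open ≡-Reasoning
    P : Triple
    P = coords (grid-point a v h)
    T : ℕ
    T = line-index k a v h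
    decoded : T / W ≡ k ℕ.* v ℕ.+ h × T % W ≡ k ℕ.* a ℕ.+ v
    decoded = divMod-encode (k ℕ.* v ℕ.+ h) (slope-bound k≤m a<s v<s)
    e≡ : fromℕ (lineE T) ≡ fromℕ k * fromℕ v + fromℕ (suc h)
    e≡ = begin
      fromℕ (suc (T / W))         ≡⟨ cong (fromℕ ∘ suc) (proj₁ decoded) ⟩
      fromℕ (suc (k ℕ.* v ℕ.+ h)) ≡⟨ cong fromℕ (sym (ℕ.+-suc (k ℕ.* v) h)) ⟩
      fromℕ (k ℕ.* v ℕ.+ suc h)   ≡⟨ fromℕ-affine k v (suc h) ⟩
      fromℕ k * fromℕ v + fromℕ (suc h) ∎
    c≡ : fromℕ (lineC k T) ≡ fromℕ k * fromℕ (X ℕ.+ a) + fromℕ v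
    c≡ = begin
      fromℕ (k ℕ.* X ℕ.+ T % W)              ≡⟨ cong (λ r → fromℕ (k ℕ.* X ℕ.+ r)) (proj₂ decoded) ⟩
      fromℕ (k ℕ.* X ℕ.+ (k ℕ.* a ℕ.+ v))    ≡⟨ cong fromℕ (regroup k X a v) ⟩
      fromℕ (k ℕ.* (X ℕ.+ a) ℕ.+ v)          ≡⟨ fromℕ-affine k (X ℕ.+ a) v ⟩
      fromℕ k * fromℕ (X ℕ.+ a) + fromℕ v    ∎
      where
      regroup : ∀ k X a v → k ℕ.* X ℕ.+ (k ℕ.* a ℕ.+ v) ≡ k ℕ.* (X ℕ.+ a) ℕ.+ v
      regroup = solve-∀

  rich : ∀ j → Rich pencil (rich-point j)
  rich j i = fromℕ< T<n ,
    subst (λ t → rich-point j ∈L pencil-line k t) (sym (Fin.toℕ-fromℕ< T<n))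
          (grid-point-on-line k (Fin.toℕ<n i) (Fin.toℕ<n a) (Fin.toℕ<n v) (Fin.toℕ<n h))
    where
    k : ℕ
    k = suc (toℕ i)
    a v h : Fin s
    a = proj₁ (digits j)
    v = proj₁ (proj₂ (digits j))
    h = proj₂ (proj₂ (digits j))
    T<n : line-index k (toℕ a) (toℕ v) (toℕ h) ℕ.< n
    T<n = line-index<n (Fin.toℕ<n i) (Fin.toℕ<n a) (Fin.toℕ<n v) (Fin.toℕ<n h)

theorem4 : (R : RealField) → let open RealField R in
    let open Projective R in
    (m : ℕ) → Σ Carrier λ c → (0# < c) ×
    ((n : ℕ) → n ≥ 1 → Σ (Fin m → Pencil n) λ P → GeneralPosition P ×
    Σ ℕ λ K → AtLeastRich P K × (c * c * fromℕ (n ^ 3) ≤ fromℕ K * fromℕ K))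
theorem4 R m = c , 0<c , configuration
  where
  open RealField R
  open Projective R
  open Data.Product using (_,_; proj₁; proj₂)
  q : ℕ
  q = ℕ.suc m
  -- c = 1 / (8 (m+1)³) turns n³ ≤ (8 (m+1)³ K)² into c² n³ ≤ K²
  scaling : Σ Carrier λ c → 0# < c ×
    (∀ a k → a ℕ.≤ (8 ℕ.* (q ℕ.* q ℕ.* q) ℕ.* k) ℕ.* (8 ℕ.* (q ℕ.* q ℕ.* q) ℕ.* k) →
             c * c * fromℕ a ≤ fromℕ k * fromℕ k)
  scaling = OrderedField.reciprocal-bound R {8 ℕ.* (q ℕ.* q ℕ.* q)} (ℕ.s≤s ℕ.z≤n)
  c : Carrier
  c = proj₁ scaling
  0<c : 0# < c
  0<c = proj₁ (proj₂ scaling)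
  configuration : (n : ℕ) → n ≥ 1 → Σ (Fin m → Pencil n) λ P → GeneralPosition P ×
    Σ ℕ λ K → AtLeastRich P K × (c * c * fromℕ (n ^ 3) ≤ fromℕ K * fromℕ K)
  configuration n 1≤n = pencil , general-position , s ℕ.* (s ℕ.* s) ,
    (rich-point , rich , rich-point-injective) ,
    proj₂ (proj₂ scaling) (n ^ 3) (s ℕ.* (s ℕ.* s)) (Arithmetic.count-bound q s n≤a²)
    where
    size : Σ ℕ λ s' → Arithmetic.line-range m s' ℕ.* Arithmetic.line-range m s' ℕ.≤ n ×
                      n ℕ.≤ (2 ℕ.* q ℕ.* ℕ.suc s') ℕ.* (2 ℕ.* q ℕ.* ℕ.suc s')
    size = Arithmetic.grid-size m n 1≤n
    open Construction R m n (proj₁ size) (proj₁ (proj₂ size))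
    n≤a² : n ℕ.≤ (2 ℕ.* q ℕ.* s) ℕ.* (2 ℕ.* q ℕ.* s)
    n≤a² = proj₂ (proj₂ size)
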